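{- Let $\sigma$ be an argumentation semantics, $\mathcal V=(V_a)_{a\in\mathcal A}$ an arbitrary basis and $\phi\in\mathcal L$. Then the point $(\emptyset,\emptyset)$ of $K^\sigma_{\mathcal V}$ and the point $(\emptyset,\emptyset)$ of $K^\sigma_{\rho_\phi(\mathcal V)}$ are $d(\phi)$-bisimilar modulo $\Pi_\phi$.
   Context: An argumentation framework (AF) is a digraph $(S,E)$ with $E\subseteq S\times S$. An argumentation semantics $\sigma$ assigns to each AF $(S,E)$ a set $\sigma(S,E)\subseteq 2^S$. Fix a finite nonempty set $\mathcal A$ of agents and a countably infinite set $\Pi$ of arguments. A basis is a family $\mathcal V=(V_a)_{a\in\mathcal A}$ with $V_a\subseteq\Pi\times\Pi$; $V_a|_T=V_a\cap(T\times T)$. Deliberative Kripke model $K^\sigma_{\mathcal V}=(C_{\mathcal V},R_{\mathcal V},\pi_\sigma)$: $C_{\mathcal V}$ is the set of pairs $q=(q_S,q_E)$ with $q_S\subseteq\Pi$, $\bigcap_aV_a|_{q_S}\subseteq q_E\subseteq\bigcup_aV_a|_{q_S}$. For $p\in\Pi$: $U(q,p)=\{X\mid\bigcap_aV_a|_{q_S\cup\{p\}}\subseteq X\subseteq\bigcup_aV_a|_{q_S\cup\{p\}}\}$, $succ(p,q)=\{(q_S\cup\{p\},q_E\cup X)\mid X\in U(q,p)\}$, $succ(q)=\bigcup_psucc(p,q)$; $R_{\mathcal V}(p)=\{(q,q')\mid q'\in succ(p,q)\}$, $R_{\mathcal V}(\exists)=\{(q,q')\mid q'\in succ(q)\}$.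 $\pi_\sigma(q)$ is the set of three-partitions $(\pi_1,\pi_0,\pi_{1/2})$ of $\Pi$ with $\pi_1\in\sigma(q_S,q_E)$, $\pi_0=\{p\in q_S\mid\exists r\in\pi_1:(r,p)\in q_E\}$. Language $\mathcal L$: inner formulas $\alpha::=p\mid\neg\alpha\mid\alpha\to\alpha$ ($p\in\Pi$); outer formulas $\phi::=\langle c\rangle\alpha\mid\neg\phi\mid\phi\wedge\phi\mid\langle p\rangle\phi\mid\Diamond\phi$. White modal depth: $d(\langle c\rangle\alpha)=0$, $d(\neg\phi)=d(\phi)$, $d(\phi\wedge\psi)=\max(d(\phi),d(\psi))$, $d(\Diamond\phi)=d(\langle p\rangle\phi)=1+d(\phi)$. $\Pi_\phi$ is the set of arguments occurring in $\phi$ inside inner subformulas. $n$-vicinity: $D(\mathcal V,\Phi,0)=\Phi$, $D(\mathcal V,\Phi,n+1)=D(\mathcal V,\Phi,n)\cup\{p\in\Pi\mid\exists r\in D(\mathcal V,\Phi,n):\{(p,r),(r,p)\}\cap\bigcup_aV_a\neq\emptyset\}$. Shrinking: with $D=D(\mathcal V,\Pi_\phi,d(\phi))$, $\rho_\phi(\mathcal V)=(V_a\cap(D\times D))_{a\in\mathcal A}$. For a point $q$ and $\Phi\subseteq\Pi$, $C(q,\Phi)$ is the digraph consisting of all connected components (ignoring edge direction) of $(q_S,q_E)$ containing an argument of $\Phi$. $n$-bisimulation modulo $\Phi$: for models $K=K^\sigma_{\mathcal V}$, $K'=K^\sigma_{\mathcal V'}$ and points $q\in C_{\mathcal V}$,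 $q'\in C_{\mathcal V'}$, we say $q,q'$ are $n$-bisimilar modulo $\Phi$ if there are relations $Z_n\subseteq Z_{n-1}\subseteq\dots\subseteq Z_0\subseteq C_{\mathcal V}\times C_{\mathcal V'}$ with (1) $qZ_nq'$; (2) if $vZ_0v'$ then $C(v,\Phi)=C(v',\Phi)$; (3) if $vZ_{i+1}v'$ and $(v,u)\in R_{\mathcal V}(s)$ for a symbol $s\in\Pi\cup\{\exists\}$, then there is $u'$ with $(v',u')\in R_{\mathcal V'}(s)$ and $uZ_iu'$; (4) symmetrically, if $vZ_{i+1}v'$ and $(v',u')\in R_{\mathcal V'}(s)$, then there is $u$ with $(v,u)\in R_{\mathcal V}(s)$ and $uZ_iu'$. -}

module Defs where

open import Level using (Level; 0ℓ) renaming (suc to lsuc)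
open import Data.Nat using (ℕ; zero; suc; _<_; _⊔_)
open import Data.Fin using (Fin)
open import Data.Product using (Σ; ∃; ∃-syntax; _×_; _,_)
open import Data.Sum using (_⊎_)
open import Data.Empty using (⊥)
open import Relation.Nullary using (¬_)
open import Relation.Binary.PropositionalEquality using (_≡_)

-- Arguments Π := ℕ (countably infinite).  Subsets of Π are predicates ℕ → Set,
-- binary relations on Π are predicates ℕ → ℕ → Set.

_⇔_ : Set → Set → Set
A ⇔ B = (A → B) × (B → A)
infix 3 _⇔_

Subset : Set₁
Subset = ℕ → Set

Rel : Set₁
Rel = ℕ → ℕ → Set

-- An argumentation semantics: σ S E X  means  X ∈ σ(S,E).
Semantics : Set₁
Semantics = Subset → Rel → Subset → Set

-- Agents: a finite nonempty set, Fin (suc m).  A basis V = (V_a)_a.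

Basis : ℕ → Set₁
Basis m = Fin (suc m) → Rel

UnionV : ∀ {m} → Basis m → Rel
UnionV V x y = ∃[ a ] V a x y

InterV : ∀ {m} → Basis m → Rel
InterV V x y = ∀ a → V a x y

restrict : Rel → Subset → Rel
restrict R T x y = R x y × T x × T y

record Point {m} (V : Basis m) : Set₁ where
  field
    qS : Subset
    qE : Rel
    lower : ∀ x y → restrict (InterV V) qS x y → qE x y
    upper : ∀ x y → qE x y → restrict (UnionV V) qS x y
open Point public

emptyPoint : ∀ {m} (V : Basis m) → Point V
emptyPoint V = record
  { qS = λ _ → ⊥
  ; qE = λ _ _ → ⊥
  ; lower = λ { x y (_ , () , _) }
  ; upper = λ { x y () }
  }

addArg : Subset → ℕ → Subset
addArg S p x = S x ⊎ x ≡ p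

InU : ∀ {m} (V : Basis m) → Point V → ℕ → Rel → Set
InU V q p X =
  (∀ x y → restrict (InterV V) (addArg (qS q) p) x y → X x y) ×
  (∀ x y → X x y → restrict (UnionV V) (addArg (qS q) p) x y)

Succ : ∀ {m} (V : Basis m) → ℕ → Point V → Point V → Set₁
Succ V p q q' = Σ Rel λ X → InU V q p X ×
  (∀ x → qS q' x ⇔ addArg (qS q) p x) ×
  (∀ x y → qE q' x y ⇔ (qE q x y ⊎ X x y))

data Sym : Set where
  arg : ℕ → Sym
  ex  : Sym

R : ∀ {m} (V : Basis m) → Sym → Point V → Point V → Set₁
R V (arg p) q q' = Succ V p q q'
R V ex      q q' = ∃[ p ] Succ V p q q'

-- valuation π_σ(q): the three-partitions (π₁,π₀,π½) of Π
Val : ∀ {m} {V : Basis m} → Semantics → Point V → Subset → Subset → Subset → Set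
Val σ q P1 P0 Ph =
  σ (qS q) (qE q) P1 ×
  (∀ x → P0 x ⇔ (qS q x × ∃[ r ] (P1 r × qE q r x))) ×
  (∀ x → P1 x ⊎ P0 x ⊎ Ph x) ×
  (∀ x → ¬ (P1 x × P0 x)) × (∀ x → ¬ (P1 x × Ph x)) × (∀ x → ¬ (P0 x × Ph x))

record KripkeModel : Set₂ where
  field
    Carrier : Set₁
    Rel'    : Sym → Carrier → Carrier → Set₁
    val     : Carrier → Subset → Subset → Subset → Set

K : ∀ {m} → Semantics → Basis m → KripkeModel
K σ V = record { Carrier = Point V ; Rel' = R V ; val = Val σ }

data Inner : Set where
  atom : ℕ → Inner
  ¬ᵢ_  : Inner → Inner
  _⇒ᵢ_ : Inner → Inner → Inner

data Outer : Set where
  ⟨c⟩_  : Inner → Outer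
  ¬ₒ_   : Outer → Outer
  _∧ₒ_  : Outer → Outer → Outer
  ⟨_⟩ₒ_ : ℕ → Outer → Outer
  ◇_    : Outer → Outer

depth : Outer → ℕ
depth (⟨c⟩ α)   = 0
depth (¬ₒ φ)    = depth φ
depth (φ ∧ₒ ψ)  = depth φ ⊔ depth ψ
depth (⟨ p ⟩ₒ φ) = suc (depth φ)
depth (◇ φ)     = suc (depth φ)

ArgsI : Inner → Subset
ArgsI (atom q) p  = p ≡ q
ArgsI (¬ᵢ α) p    = ArgsI α p
ArgsI (α ⇒ᵢ β) p  = ArgsI α p ⊎ ArgsI β p

ArgsO : Outer → Subset
ArgsO (⟨c⟩ α) p     = ArgsI α p
ArgsO (¬ₒ φ) p      = ArgsO φ p
ArgsO (φ ∧ₒ ψ) p    = ArgsO φ p ⊎ ArgsO ψ p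
ArgsO (⟨ q ⟩ₒ φ) p  = ArgsO φ p
ArgsO (◇ φ) p       = ArgsO φ p

Vicinity : ∀ {m} → Basis m → Subset → ℕ → Subset
Vicinity V Φ zero p    = Φ p
Vicinity V Φ (suc n) p =
  Vicinity V Φ n p ⊎
  (∃[ r ] (Vicinity V Φ n r × (UnionV V p r ⊎ UnionV V r p)))

shrink : ∀ {m} → Outer → Basis m → Basis m
shrink φ V a x y = V a x y × D x × D y
  where D = Vicinity V (ArgsO φ) (depth φ)

-- C(q,Φ): union of the (undirected) connected components of (q_S,q_E)
-- containing an argument of Φ.

data Reach {m} {V : Basis m} (q : Point V) : ℕ → ℕ → Set where
  here : ∀ {x} → qS q x → Reach q x x
  fwd  : ∀ {x y z} → Reach q x y → qE q y z → Reach q x z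
  bwd  : ∀ {x y z} → Reach q x y → qE q z y → Reach q x z

CVert : ∀ {m} {V : Basis m} → Point V → Subset → Subset
CVert q Φ x = ∃[ y ] (Φ y × Reach q y x)

CEdge : ∀ {m} {V : Basis m} → Point V → Subset → Rel
CEdge q Φ x y = qE q x y × CVert q Φ x

SameC : ∀ {m m'} {V : Basis m} {V' : Basis m'} → Point V → Point V' → Subset → Set
SameC v v' Φ = (∀ x → CVert v Φ x ⇔ CVert v' Φ x) ×
               (∀ x y → CEdge v Φ x y ⇔ CEdge v' Φ x y)

-- n-bisimulation modulo Φ between points of K^σ_V and K^σ_V'.
-- The relations Z_0 ⊇ … ⊇ Z_n are given as Z i for i ≤ n (Z i for i > n unused).

record NBisim {m m'} (σ : Semantics) (V : Basis m) (V' : Basis m') (n : ℕ) (Φ : Subset)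
              (q : Point V) (q' : Point V') : Set₂ where
  field
    Z     : ℕ → Point V → Point V' → Set₁
    start : Z n q q'
    mono  : ∀ i → i < n → ∀ v v' → Z (suc i) v v' → Z i v v'
    atoms : ∀ v v' → Z 0 v v' → SameC v v' Φ
    forth : ∀ i → i < n → ∀ v v' → Z (suc i) v v' → ∀ s u →
              KripkeModel.Rel' (K σ V) s v u →
              Σ (Point V') λ u' → KripkeModel.Rel' (K σ V') s v' u' × Z i u u'
    back  : ∀ i → i < n → ∀ v v' → Z (suc i) v v' → ∀ s u' →
              KripkeModel.Rel' (K σ V') s v' u' →
              Σ (Point V) λ u → KripkeModel.Rel' (K σ V) s v u × Z i u u'

module Submission where

-- Let D be the n-vicinity of Φ (n = d(φ), Φ = Π_φ) and V↾ the basis V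
-- cut down to D × D, so V↾ = ρ_φ(V).  Points v of K_V and v' of K_V↾ are related at
-- level i when (a) they agree modulo D (same arguments, and the attacks of v' are
-- the attacks of v inside D) and (b) v has at most n ∸ i arguments.  Agreement is
-- preserved by moves both ways: adding X on one side is matched by adding X ∩ (D × D),
-- respectively X' together with the common attacks ⋂_a V_a; each move adds one
-- argument.  At level 0 a point has at most n arguments, so a shortest undirected
-- path from Φ inside it has at most n edges: every component meeting Φ lies in D,
-- and agreement gives C(v,Φ) = C(v',Φ).

open import Defs
open import Data.Nat using (ℕ; zero; suc; _∸_; _≤_; z≤n; s≤s)
open import Data.Nat.Properties
  using (_≟_; ≤-trans; n≤1+n; n<1+n; ∸-monoʳ-≤; ∸-monoʳ-<; module ≤-Reasoning)
import Data.Fin as Fin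
open import Data.List using (List; []; _∷_; [_]; length)
open import Data.List.Properties using (length-removeAt′)
open import Data.List.Relation.Unary.Any using (here; there; index; _─_)
import Data.List.Relation.Unary.All as All
open import Data.List.Relation.Unary.All.Properties using (¬Any⇒All¬)
open import Data.List.Relation.Unary.Unique.Propositional using (Unique; []; _∷_)
open import Data.List.Membership.Propositional using (_∈_)
open import Data.List.Membership.DecPropositional _≟_ using (_∈?_)
open import Data.List.Relation.Binary.Subset.Propositional using (_⊆_)
open import Data.List.Relation.Binary.Subset.Propositional.Properties
  using (⊆-refl; ⊆-trans; xs⊆x∷xs; ∷⁺ʳ)
open import Data.Product using (Σ; ∃; _×_; _,_; proj₁; proj₂)
open import Data.Sum using (_⊎_; inj₁; inj₂)
import Data.Sum as Sum
open import Data.Empty using (⊥-elim)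
open import Function using (id; _∘_)
open import Relation.Nullary using (yes; no)
open import Relation.Binary.PropositionalEquality using (_≢_; refl; sym)

∈-─ : ∀ {x z} {ys : List ℕ} (x∈ys : x ∈ ys) → z ∈ ys → z ≢ x → z ∈ (ys ─ x∈ys)
∈-─ (here refl) (here refl)  z≢x = ⊥-elim (z≢x refl)
∈-─ (here _)    (there z∈ys) _   = z∈ys
∈-─ (there _)   (here z≡y)   _   = here z≡y
∈-─ (there x∈ys) (there z∈ys) z≢x = there (∈-─ x∈ys z∈ys z≢x)

unique-length : ∀ {xs ys : List ℕ} → Unique xs → xs ⊆ ys → length xs ≤ length ys
unique-length {[]}     _               _     = z≤n
unique-length {x ∷ xs} {ys} (x∉xs ∷ uniq) xs⊆ys = begin
  suc (length xs)          ≤⟨ s≤s (unique-length uniq tail⊆) ⟩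
  suc (length (ys ─ x∈ys)) ≡⟨ sym (length-removeAt′ ys (index x∈ys)) ⟩
  length ys                ∎
  where
  open ≤-Reasoning
  x∈ys : x ∈ ys
  x∈ys = xs⊆ys (here refl)
  tail⊆ : xs ⊆ (ys ─ x∈ys)
  tail⊆ z∈xs = ∈-─ x∈ys (xs⊆ys (there z∈xs)) (λ z≡x → All.lookup x∉xs z∈xs (sym z≡x))

-- "S has at most k elements", witnessed by a covering list of length ≤ k.
Covered : ℕ → Subset → Set
Covered k S = Σ (List ℕ) λ L → (∀ {x} → S x → x ∈ L) × length L ≤ k

covered-mono : ∀ {k k' S} → k ≤ k' → Covered k S → Covered k' S
covered-mono k≤k' (L , covers , len) = L , covers , ≤-trans len k≤k'

-- The set of agents is nonempty, so common attacks are attacks of some agent.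
inter⊆union : ∀ {m} {W : Basis m} {x y} → InterV W x y → UnionV W x y
inter⊆union common = Fin.zero , common Fin.zero

vicinity-base : ∀ {m} {W : Basis m} {Φ : Subset} {y} k → Φ y → Vicinity W Φ k y
vicinity-base zero    φy = φy
vicinity-base (suc k) φy = inj₁ (vicinity-base k φy)

module Walks {m} {W : Basis m} (q : Point W) where

  Adjacent : ℕ → ℕ → Set
  Adjacent x z = qE q x z ⊎ qE q z x

  adjacent-in-basis : ∀ {x z} → Adjacent x z → UnionV W z x ⊎ UnionV W x z
  adjacent-in-basis (inj₁ e) = inj₂ (proj₁ (upper q _ _ e))
  adjacent-in-basis (inj₂ e) = inj₁ (proj₁ (upper q _ _ e))

  -- Walk y x ws: a walk from y to x visiting ws (most recent vertex first).
  infixl 5 _▹_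
  data Walk (y : ℕ) : ℕ → List ℕ → Set where
    start : qS q y → Walk y y [ y ]
    _▹_   : ∀ {x z ws} → Walk y x ws → Adjacent x z → Walk y z (z ∷ ws)

  reach⇒walk : ∀ {y x} → Reach q y x → ∃ (Walk y x)
  reach⇒walk (here s)  = _ , start s
  reach⇒walk (fwd r e) = _ , proj₂ (reach⇒walk r) ▹ inj₁ e
  reach⇒walk (bwd r e) = _ , proj₂ (reach⇒walk r) ▹ inj₂ e

  walk-args : ∀ {y x ws u} → Walk y x ws → u ∈ ws → qS q u
  walk-args (start s)      (here refl) = s
  walk-args (_ ▹ inj₁ e)   (here refl) = proj₂ (proj₂ (upper q _ _ e))
  walk-args (_ ▹ inj₂ e)   (here refl) = proj₁ (proj₂ (upper q _ _ e))
  walk-args (w ▹ _)        (there u∈ws) = walk-args w u∈ws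

  ShorterWalk : ℕ → ℕ → List ℕ → Set
  ShorterWalk y x ws = Σ (List ℕ) λ ws' → Walk y x ws' × Unique ws' × ws' ⊆ ws

  truncate : ∀ {y x z ws} → Walk y x ws → Unique ws → z ∈ ws → ShorterWalk y z ws
  truncate w@(start _) uniq (here refl) = _ , w , uniq , ⊆-refl
  truncate w@(_ ▹ _)   uniq (here refl) = _ , w , uniq , ⊆-refl
  truncate (w ▹ _) (_ ∷ uniq) (there z∈ws) =
    let (ws' , w' , uniq' , ws'⊆ws) = truncate w uniq z∈ws
    in ws' , w' , uniq' , ⊆-trans ws'⊆ws (xs⊆x∷xs _ _)

  shortcut : ∀ {y x ws} → Walk y x ws → ShorterWalk y x ws
  shortcut w@(start _) = _ , w , All.[] ∷ [] , ⊆-refl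
  shortcut (_▹_ {z = z} w adj) with shortcut w
  ... | ws' , w' , uniq , ws'⊆ws with z ∈? ws'
  ...   | yes z∈ws' =
    let (ws'' , w'' , uniq'' , ws''⊆ws') = truncate w' uniq z∈ws'
    in ws'' , w'' , uniq'' , ⊆-trans ws''⊆ws' (⊆-trans ws'⊆ws (xs⊆x∷xs _ z))
  ...   | no z∉ws' = z ∷ ws' , w' ▹ adj , ¬Any⇒All¬ ws' z∉ws' ∷ uniq , ∷⁺ʳ z ws'⊆ws

  walk-in-vicinity : ∀ {Φ y x ws} k → Φ y → Walk y x ws → length ws ≤ suc k →
                     Vicinity W Φ k x
  walk-in-vicinity k       φy (start _)           _         = vicinity-base k φy
  walk-in-vicinity zero    φy (start _ ▹ _)       (s≤s ())
  walk-in-vicinity zero    φy (_ ▹ _ ▹ _)         (s≤s ())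
  walk-in-vicinity (suc k) φy (_▹_ {x = x} w adj) (s≤s len) =
    inj₂ (x , walk-in-vicinity k φy w len , adjacent-in-basis adj)

  reach-in-vicinity : ∀ {Φ y x} k → Covered (suc k) (qS q) → Φ y → Reach q y x →
                      Vicinity W Φ k x
  reach-in-vicinity k (L , covers , len) φy r =
    let (_ , w) = reach⇒walk r
        (_ , w' , uniq , _) = shortcut w
    in walk-in-vicinity k φy w' (≤-trans (unique-length uniq (covers ∘ walk-args w')) len)

open Walks using (reach-in-vicinity)

extend : ∀ {m} {W : Basis m} (q : Point W) (p : ℕ) (X : Rel) → InU W q p X → Point W
extend q p X (X-lower , X-upper) = record
  { qS    = addArg (qS q) p
  ; qE    = λ x y → qE q x y ⊎ X x y
  ; lower = λ x y common → inj₂ (X-lower x y common)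
  ; upper = λ { x y (inj₁ e) → let (ue , sx , sy) = upper q x y e in ue , inj₁ sx , inj₁ sy
              ; x y (inj₂ e) → X-upper x y e }
  }

extend-succ : ∀ {m} {W : Basis m} q p X (X∈U : InU W q p X) → Succ W p q (extend q p X X∈U)
extend-succ q p X X∈U = X , X∈U , (λ _ → id , id) , (λ _ _ → id , id)

covered-succ : ∀ {m} {W : Basis m} {k p q u} → Covered k (qS q) → Succ W p q u →
               Covered (suc k) (qS u)
covered-succ {p = p} {u = u} (L , covers , len) (_ , _ , args , _) = p ∷ L , covers' , s≤s len
  where
  covers' : ∀ {x} → qS u x → x ∈ p ∷ L
  covers' {x} s with proj₁ (args x) s
  ... | inj₁ s'   = there (covers s')
  ... | inj₂ refl = here refl

-- A simulation of every argument move p is a simulation of every symbol, since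
-- the ∃-move is the union of the argument moves.
lift-sym : ∀ {m m'} {W : Basis m} {W' : Basis m'} {w w'} (T : Point W → Point W' → Set₁) →
  (∀ p u → Succ W p w u → Σ (Point W') λ u' → Succ W' p w' u' × T u u') →
  ∀ s u → R W s w u → Σ (Point W') λ u' → R W' s w' u' × T u u'
lift-sym T step (arg p) u st       = step p u st
lift-sym T step ex      u (p , st) = let (u' , st' , t) = step p u st in u' , (p , st') , t

module Restriction {m} (V : Basis m) (D : Subset) where

  V↾ : Basis m
  V↾ a x y = V a x y × D x × D y

  record Agree (v : Point V) (v' : Point V↾) : Set₁ where
    field
      sameArgs  : ∀ x → qS v x ⇔ qS v' x
      sameEdges : ∀ x y → qE v' x y ⇔ (qE v x y × D x × D y)

    extendedArgs : ∀ p x → addArg (qS v) p x ⇔ addArg (qS v') p x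
    extendedArgs p x = Sum.map₁ (proj₁ (sameArgs x)) , Sum.map₁ (proj₂ (sameArgs x))

  open Agree

  agree-empty : Agree (emptyPoint V) (emptyPoint V↾)
  agree-empty = record { sameArgs  = λ _ → (λ ()) , (λ ())
                       ; sameEdges = λ _ _ → (λ ()) , (λ { (() , _) }) }

  agree-sameC : ∀ {v v' Φ} → Agree v v' → (∀ {y x} → Φ y → Reach v y x → D x) →
                SameC v v' Φ
  agree-sameC {v} {v'} {Φ} ag near = (λ _ → vert→ , vert←) , (λ _ _ → edge→ , edge←)
    where
    keep : ∀ {x z} → qE v x z → D x → D z → qE v' x z
    keep e dx dz = proj₂ (sameEdges ag _ _) (e , dx , dz)

    forget : ∀ {x z} → qE v' x z → qE v x z
    forget e = proj₁ (proj₁ (sameEdges ag _ _) e)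

    reach→ : ∀ {y x} → Φ y → Reach v y x → Reach v' y x
    reach→ φy (here s)  = here (proj₁ (sameArgs ag _) s)
    reach→ φy (fwd r e) = fwd (reach→ φy r) (keep e (near φy r) (near φy (fwd r e)))
    reach→ φy (bwd r e) = bwd (reach→ φy r) (keep e (near φy (bwd r e)) (near φy r))

    reach← : ∀ {y x} → Reach v' y x → Reach v y x
    reach← (here s)  = here (proj₂ (sameArgs ag _) s)
    reach← (fwd r e) = fwd (reach← r) (forget e)
    reach← (bwd r e) = bwd (reach← r) (forget e)

    vert→ : ∀ {x} → CVert v Φ x → CVert v' Φ x
    vert→ (y , φy , r) = y , φy , reach→ φy r

    vert← : ∀ {x} → CVert v' Φ x → CVert v Φ x
    vert← (y , φy , r) = y , φy , reach← r

    edge→ : ∀ {x z} → CEdge v Φ x z → CEdge v' Φ x z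
    edge→ (e , y , φy , r) = keep e (near φy r) (near φy (fwd r e)) , vert→ (y , φy , r)

    edge← : ∀ {x z} → CEdge v' Φ x z → CEdge v Φ x z
    edge← (e , c) = forget e , vert← c

  agree-succ : ∀ {p v v' u u'} → Agree v v' → (s : Succ V p v u) (s' : Succ V↾ p v' u') →
               (∀ x y → proj₁ s' x y ⇔ (proj₁ s x y × D x × D y)) → Agree u u'
  agree-succ {p} {v} {v'} {u} {u'} ag (X , _ , args , edges) (X' , _ , args' , edges') X'≡X↾ =
    record { sameArgs = λ x → proj₂ (args' x) ∘ proj₁ (extendedArgs ag p x) ∘ proj₁ (args x)
                            , proj₂ (args x) ∘ proj₂ (extendedArgs ag p x) ∘ proj₁ (args' x)
           ; sameEdges = λ x y → edge→ ∘ proj₁ (edges' x y) , proj₂ (edges' x y) ∘ edge← }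
    where
    edge→ : ∀ {x y} → qE v' x y ⊎ X' x y → qE u x y × D x × D y
    edge→ {x} {y} (inj₁ e') = let (e , dx , dy) = proj₁ (sameEdges ag x y) e'
                              in proj₂ (edges x y) (inj₁ e) , dx , dy
    edge→ {x} {y} (inj₂ e') = let (e , dx , dy) = proj₁ (X'≡X↾ x y) e'
                              in proj₂ (edges x y) (inj₂ e) , dx , dy

    edge← : ∀ {x y} → qE u x y × D x × D y → qE v' x y ⊎ X' x y
    edge← {x} {y} (e , dx , dy) with proj₁ (edges x y) e
    ... | inj₁ e₀ = inj₁ (proj₂ (sameEdges ag x y) (e₀ , dx , dy))
    ... | inj₂ e₀ = inj₂ (proj₂ (X'≡X↾ x y) (e₀ , dx , dy))

  -- Forth: a move adding X in K_V is matched by the move adding X ∩ (D × D).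
  forth-step : ∀ {p v v' u} → Agree v v' → Succ V p v u →
               Σ (Point V↾) λ u' → Succ V↾ p v' u' × Agree u u'
  forth-step {p} {v} {v'} ag s@(X , (X-lower , X-upper) , _) =
    extend v' p X↾ X↾∈U , s' , agree-succ ag s s' (λ _ _ → id , id)
    where
    X↾ : Rel
    X↾ x y = X x y × D x × D y

    X↾∈U : InU V↾ v' p X↾
    X↾∈U = (λ x y (common , sx , sy) →
               X-lower x y ( (λ a → proj₁ (common a))
                           , proj₂ (extendedArgs ag p x) sx , proj₂ (extendedArgs ag p y) sy)
             , proj₂ (proj₂ (inter⊆union {W = V↾} common)))
         , (λ x y (e , dx , dy) →
               let ((a , attack) , sx , sy) = X-upper x y e
               in (a , attack , dx , dy)
                , proj₁ (extendedArgs ag p x) sx , proj₁ (extendedArgs ag p y) sy)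

    s' : Succ V↾ p v' (extend v' p X↾ X↾∈U)
    s' = extend-succ v' p X↾ X↾∈U

  -- Back: a move adding X' in K_V↾ is matched by the move adding X' together with
  -- the common attacks ⋂_a V_a on q_S ∪ {p}, which X' already contains inside D.
  back-step : ∀ {p v v' u'} → Agree v v' → Succ V↾ p v' u' →
              Σ (Point V) λ u → Succ V p v u × Agree u u'
  back-step {p} {v} {v'} ag s'@(X' , (X'-lower , X'-upper) , _) =
    extend v p X X∈U , s , agree-succ ag s s' (λ x y → X'→X↾ , X↾→X')
    where
    Common : Rel
    Common = restrict (InterV V) (addArg (qS v) p)

    X : Rel
    X x y = X' x y ⊎ Common x y

    X∈U : InU V v p X
    X∈U = (λ _ _ → inj₂)
        , (λ { x y (inj₁ e') →
                 let ((a , attack , _) , sx , sy) = X'-upper x y e'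
                 in (a , attack) , proj₂ (extendedArgs ag p x) sx , proj₂ (extendedArgs ag p y) sy
             ; x y (inj₂ (common , sx , sy)) → inter⊆union {W = V} common , sx , sy })

    s : Succ V p v (extend v p X X∈U)
    s = extend-succ v p X X∈U

    X'→X↾ : ∀ {x y} → X' x y → X x y × D x × D y
    X'→X↾ {x} {y} e' = let ((_ , _ , dx , dy) , _) = X'-upper x y e' in inj₁ e' , dx , dy

    X↾→X' : ∀ {x y} → X x y × D x × D y → X' x y
    X↾→X' (inj₁ e' , _) = e'
    X↾→X' {x} {y} (inj₂ (common , sx , sy) , dx , dy) =
      X'-lower x y ( (λ a → common a , dx , dy)
                   , proj₁ (extendedArgs ag p x) sx , proj₁ (extendedArgs ag p y) sy)

module Bisimulation {m} (σ : Semantics) (V : Basis m) (Φ : Subset) (n : ℕ) where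
  open Restriction V (Vicinity V Φ n)

  Z : ℕ → Point V → Point V↾ → Set₁
  Z i v v' = Agree v v' × Covered (n ∸ i) (qS v)

  budget-step : ∀ {i p} v u → suc i ≤ n → Covered (n ∸ suc i) (qS v) → Succ V p v u →
                Covered (n ∸ i) (qS u)
  budget-step {i} v u i<n cov st =
    covered-mono (∸-monoʳ-< (n<1+n i) i<n) (covered-succ {W = V} {q = v} {u = u} cov st)

  bisim : NBisim σ V V↾ n Φ (emptyPoint V) (emptyPoint V↾)
  bisim = record
    { Z     = Z
    ; start = agree-empty , [] , (λ ()) , z≤n
    ; mono  = λ i _ _ _ (ag , cov) → ag , covered-mono (∸-monoʳ-≤ n (n≤1+n i)) cov
    ; atoms = λ v _ (ag , cov) →
                agree-sameC ag (reach-in-vicinity v n (covered-mono (n≤1+n n) cov))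
    ; forth = λ i i<n v _ (ag , cov) → lift-sym (Z i) λ p u st →
                let (u' , st' , ag') = forth-step ag st
                in u' , st' , ag' , budget-step v u i<n cov st
    ; back  = λ i i<n v _ (ag , cov) → lift-sym (λ u' u → Z i u u') λ p u' st' →
                let (u , st , ag') = back-step ag st'
                in u , st , ag' , budget-step v u i<n cov st
    }

theorem1 : (σ : Semantics) (m : ℕ) (V : Basis m) (φ : Outer) →
    NBisim σ V (shrink φ V) (depth φ) (ArgsO φ) (emptyPoint V) (emptyPoint (shrink φ V))
theorem1 σ m V φ = Bisimulation.bisim σ V (ArgsO φ) (depth φ)
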